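{- Let $(((V,E),\lambda),r)$ be a rooted temporal graph and suppose $S = v_1,\dots,v_\ell$ is a strategy for \textsc{Temporal Firefighter} on it that saves at least $k$ vertices. Let $F$ be any set of additional edges (between vertices of $V$) not in $E$, and let $\lambda' : E \cup F \to 2^{\mathbb{N}}$ be a labelling function with $\lambda'|_E = \lambda$ and $\min(\lambda'(f)) \ge |V|-1$ for all $f \in F$. Let $S'$ be the strategy consisting of all the defences of $S$ (in the same order) followed by defending every remaining vertex that is neither burning nor defended, one per timestep, in an arbitrary order. Then $S'$ saves at least $k$ vertices in \textsc{Temporal Firefighter} on $(((V,E\cup F),\lambda'),r)$.
   Context: A temporal graph is a pair $(G,\lambda)$ with $G=(V,E)$ a finite undirected loop-free graph and $\lambda: E \to 2^{\mathbb{N}}$ assigning to each edge the set of timesteps at which it is active; $u,v$ are temporally adjacent at time $t$ if $uv\in E$ and $t \in \lambda(uv)$. \textsc{Temporal Firefighter} on a rooted temporal graph $((G,\lambda),r)$: at time $t=0$ the root $r$ is burning; at each time $t\ge 1$ a chosen vertex that is neither burning nor already defended (a valid defence) is labelled defended, and then the fire spreads from every burning vertex to every vertex that is neither burning nor defended and temporally adjacent to it at time $t$; the process ends once the fire can no longer spread. A strategy is a sequence $v_1,\dots,v_\ell$ where each $v_i$ is a valid defence on timestep $i$ (no defences are made after timestep $\ell$). A vertex is saved if it is not burning when the process ends. -}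

module Defs where

open import Data.Nat using (ℕ; zero; suc; _≤_; _∸_)
open import Data.Fin using (Fin; toℕ)
open import Data.List using (List; take; length; lookup; _++_)
open import Data.List.Membership.Propositional using (_∈_; _∉_)
open import Data.Product using (Σ; _×_)
open import Data.Sum using (_⊎_)
open import Relation.Nullary using (¬_)
open import Relation.Binary.PropositionalEquality using (_≡_)
open import Function.Definitions using (Injective)

-- A temporal graph on the vertex set V = Fin n.
-- Edge u v : the (undirected, loop-free) edge relation of G.
-- label u v t : t ∈ λ(uv)  (λ(uv) is an arbitrary subset of ℕ, given as a predicate).
record TemporalGraph (n : ℕ) : Set₁ where
  field
    Edge      : Fin n → Fin n → Set
    label     : Fin n → Fin n → ℕ → Set
    edge-sym  : ∀ {u v} → Edge u v → Edge v u
    loop-free : ∀ {v} → ¬ Edge v v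
    label-sym : ∀ {u v t} → label u v t → label v u t

open TemporalGraph public

TAdj : ∀ {n} → TemporalGraph n → Fin n → Fin n → ℕ → Set
TAdj G u v t = Edge G u v × label G u v t

-- A strategy is a list of vertices; the i-th element (1-based) is defended at timestep i.
Strategy : ℕ → Set
Strategy n = List (Fin n)

Defended : ∀ {n} → Strategy n → ℕ → Fin n → Set
Defended S t v = v ∈ take t S

-- Burning G r S t v : v is burning at the end of timestep t
-- (after the defence of timestep t and the spread of timestep t).
data Burning {n} (G : TemporalGraph n) (r : Fin n) (S : Strategy n) : ℕ → Fin n → Set where
  root   : Burning G r S 0 r
  stay   : ∀ {t v} → Burning G r S t v → Burning G r S (suc t) v
  spread : ∀ {t u v} → Burning G r S t u → TAdj G u v (suc t) →
           ¬ Defended S (suc t) v → Burning G r S (suc t) v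

-- Every defence v_i (at timestep i = toℕ j + 1) is valid: v_i is neither
-- burning nor already defended at the start of timestep i.
ValidStrategy : ∀ {n} → TemporalGraph n → Fin n → Strategy n → Set
ValidStrategy G r S =
  (j : Fin (length S)) →
    ¬ Burning G r S (toℕ j) (lookup S j) × ¬ Defended S (toℕ j) (lookup S j)

Saved : ∀ {n} → TemporalGraph n → Fin n → Strategy n → Fin n → Set
Saved G r S v = ∀ t → ¬ Burning G r S t v

SavesAtLeast : ∀ {n} → TemporalGraph n → Fin n → Strategy n → ℕ → Set
SavesAtLeast {n} G r S k =
  Σ (Fin k → Fin n) (λ f → Injective _≡_ _≡_ f × (∀ i → Saved G r S (f i)))

-- G' is obtained from G by adding a set F of new edges (F = Edge G' \ Edge G),
-- with λ'|_E = λ and every label of a new edge ≥ |V| - 1.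
Extension : ∀ {n} → TemporalGraph n → TemporalGraph n → Set
Extension {n} G G' =
  (∀ {u v} → Edge G u v → Edge G' u v) ×
  (∀ {u v t} → Edge G u v → (label G' u v t → label G u v t) × (label G u v t → label G' u v t)) ×
  (∀ {u v t} → Edge G' u v → ¬ Edge G u v → label G' u v t → n ∸ 1 ≤ t)

-- S' = S ++ T where T defends, one per timestep, remaining vertices that are
-- neither burning nor defended, until no such vertex remains:
-- S ++ T is a valid strategy and, at the end of its last timestep, every vertex
-- is burning or defended.
Completion : ∀ {n} → TemporalGraph n → Fin n → Strategy n → Strategy n → Set
Completion {n} G' r S T =
  ValidStrategy G' r (S ++ T) ×
  (∀ (v : Fin n) → Burning G' r (S ++ T) (length (S ++ T)) v ⊎ v ∈ (S ++ T))

{-# OPTIONS --safe #-}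
module Submission where

-- The fire on G' can only differ from the fire on G along a new edge, whose
-- labels are all at least |V| - 1.  A valid strategy defends distinct non-root
-- vertices, so it lasts at most |V| - 1 steps; if it is still running at step
-- |V| - 1, every non-root vertex has been defended by then and there is nothing
-- left for a new edge to ignite.  Hence, up to the end of S ++ T, the fire on
-- G' is contained in the fire on G under S.  A vertex saved by S is therefore
-- not burning on G' when S ++ T ends, so by completeness of S ++ T it is
-- defended, and defended vertices never burn.

open import Defs
open import Data.Nat using (ℕ; zero; suc; _≤_; _<_; _≤′_; ≤′-refl; ≤′-step; s≤s)
open import Data.Nat.Properties
  using (≤-trans; ≤-refl; n≤1+n; <-cmp; <-irrefl; _<?_; ≮⇒≥; ≤⇒≤′; <-≤-trans)
open import Data.Fin using (Fin; toℕ; _≟_) renaming (zero to fzero; suc to fsuc)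
open import Data.Fin.Properties using (injective⇒≤; punchOut-injective; toℕ-injective)
open import Data.List using (List; _∷_; take; length; lookup; _++_)
open import Data.List.Properties using (take-all)
open import Data.List.Membership.Propositional using (_∈_; _∉_)
open import Data.List.Membership.Propositional.Properties using (∈-lookup)
open import Data.List.Relation.Unary.Any using (here; there; index)
open import Data.List.Relation.Unary.Any.Properties using (lookup-index)
open import Data.Product using (_,_; proj₁; proj₂)
open import Data.Sum using (_⊎_; inj₁; inj₂)
open import Level using (0ℓ)
open import Effect.Monad using (RawMonad)
open import Function using (_∘_)
open import Function.Definitions using (Injective)
open import Relation.Binary using (tri<; tri≈; tri>)
open import Relation.Binary.PropositionalEquality using (_≡_; _≢_; refl; sym; cong; subst)
open import Relation.Nullary using (¬_; Dec; yes; no; contradiction)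
open import Relation.Nullary.Negation using (¬¬-Monad)
open import Relation.Nullary.Decidable using (¬¬-excluded-middle)

lookup∈take : ∀ {A : Set} (xs : List A) (j : Fin (length xs)) {s} →
  toℕ j < s → lookup xs j ∈ take s xs
lookup∈take (x ∷ xs) fzero   {suc s} _       = here refl
lookup∈take (x ∷ xs) (fsuc j) {suc s} (s≤s p) = there (lookup∈take xs j p)

∈-take-++⁺ˡ : ∀ {A : Set} (xs ys : List A) {s x} → x ∈ take s xs → x ∈ take s (xs ++ ys)
∈-take-++⁺ˡ (x ∷ xs) ys {suc s} (here p)  = here p
∈-take-++⁺ˡ (x ∷ xs) ys {suc s} (there p) = there (∈-take-++⁺ˡ xs ys p)

injective-avoiding⇒≤ : ∀ {k m} (r : Fin (suc m)) {f : Fin k → Fin (suc m)} →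
  Injective _≡_ _≡_ f → (∀ i → f i ≢ r) → k ≤ m
injective-avoiding⇒≤ r f-inj f≢r =
  injective⇒≤ (λ {i} {j} → f-inj ∘ punchOut-injective (f≢r i ∘ sym) (f≢r j ∘ sym))

module _ {n} (G : TemporalGraph n) (r : Fin n) (X : Strategy n) where

  Burning-root : ∀ t → Burning G r X t r
  Burning-root zero    = root
  Burning-root (suc t) = stay (Burning-root t)

  Burning-mono : ∀ {t t' v} → t ≤ t' → Burning G r X t v → Burning G r X t' v
  Burning-mono = go ∘ ≤⇒≤′
    where
    go : ∀ {t t' v} → t ≤′ t' → Burning G r X t v → Burning G r X t' v
    go ≤′-refl       b = b
    go (≤′-step t≤t') b = stay (go t≤t' b)

  module _ (valid : ValidStrategy G r X) where

    lookup-injective : Injective _≡_ _≡_ (lookup X)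
    lookup-injective {i} {j} eq with <-cmp (toℕ i) (toℕ j)
    ... | tri≈ _ i≡j _ = toℕ-injective i≡j
    ... | tri< i<j _ _ =
      contradiction (subst (_∈ take (toℕ j) X) eq (lookup∈take X i i<j)) (proj₂ (valid j))
    ... | tri> _ _ j<i =
      contradiction (subst (_∈ take (toℕ i) X) (sym eq) (lookup∈take X j j<i)) (proj₂ (valid i))

    lookup≢root : ∀ j → lookup X j ≢ r
    lookup≢root j eq = proj₁ (valid j) (subst (Burning G r X (toℕ j)) (sym eq) (Burning-root (toℕ j)))

    -- Before its defence a vertex is not burning by validity; afterwards the
    -- fire cannot spread to it.
    lookup-never-burns : ∀ j {t} → ¬ Burning G r X t (lookup X j)
    lookup-never-burns j {t} b with toℕ j <? t
    ... | no j≮t = proj₁ (valid j) (Burning-mono (≮⇒≥ j≮t) b)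
    lookup-never-burns j (stay b)         | yes _   = lookup-never-burns j b
    lookup-never-burns j (spread _ _ ¬def) | yes j<t = ¬def (lookup∈take X j j<t)

    ∈⇒never-burns : ∀ {v t} → v ∈ X → ¬ Burning G r X t v
    ∈⇒never-burns v∈X =
      subst (λ v → ¬ Burning G r X _ v) (sym (lookup-index v∈X)) (lookup-never-burns (index v∈X))

module _ {m} (G : TemporalGraph (suc m)) (r : Fin (suc m)) (X : Strategy (suc m))
         (valid : ValidStrategy G r X) where

  length≤ : length X ≤ m
  length≤ = injective-avoiding⇒≤ r (lookup-injective G r X valid) (lookup≢root G r X valid)

  ∉⇒length< : ∀ {w} → w ∉ X → w ≢ r → length X < m
  ∉⇒length< {w} w∉X w≢r = injective-avoiding⇒≤ r {f = lookup (w ∷ X)} inj avoids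
    where
    inj : Injective _≡_ _≡_ (lookup (w ∷ X))
    inj {fzero}  {fzero}  _  = refl
    inj {fzero}  {fsuc j} eq = contradiction (subst (_∈ X) (sym eq) (∈-lookup j)) w∉X
    inj {fsuc i} {fzero}  eq = contradiction (subst (_∈ X) eq (∈-lookup i)) w∉X
    inj {fsuc i} {fsuc j} eq = cong fsuc (lookup-injective G r X valid eq)
    avoids : ∀ i → lookup (w ∷ X) i ≢ r
    avoids fzero    = w≢r
    avoids (fsuc j) = lookup≢root G r X valid j

  undefended-late⇒root : ∀ {t w} → m ≤ t → t ≤ length X → ¬ Defended X t w → w ≡ r
  undefended-late⇒root {t} {w} m≤t t≤L ¬def with w ≟ r
  ... | yes w≡r = w≡r
  ... | no w≢r  = contradiction (<-≤-trans (∉⇒length< w∉X w≢r) (≤-trans m≤t t≤L)) (<-irrefl refl)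
    where
    w∉X : w ∉ X
    w∉X = ¬def ∘ subst (w ∈_) (sym (take-all t X (≤-trans length≤ m≤t)))

module _ {m} {G G' : TemporalGraph (suc m)} {r : Fin (suc m)} {S T : Strategy (suc m)}
         (ext : Extension G G') (valid : ValidStrategy G' r (S ++ T)) where

  open RawMonad (¬¬-Monad {0ℓ})

  -- Double negation because Edge G need not be decidable.
  burning-in-extension : ∀ {t u} → t ≤ length (S ++ T) →
    Burning G' r (S ++ T) t u → ¬ ¬ Burning G r S t u
  burning-in-extension _   root     = pure root
  burning-in-extension t≤L (stay b) = stay <$> burning-in-extension (≤-trans (n≤1+n _) t≤L) b
  burning-in-extension {suc t} {w} t≤L (spread {u = u} b (e' , l') ¬def) = do
    b-old ← burning-in-extension (≤-trans (n≤1+n _) t≤L) b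
    edge? ← ¬¬-excluded-middle
    pure (spread-along b-old edge?)
    where
    spread-along : Burning G r S t u → Dec (Edge G u w) → Burning G r S (suc t) w
    spread-along b-old (yes e) =
      spread b-old (e , proj₁ (proj₁ (proj₂ ext) e) l') (¬def ∘ ∈-take-++⁺ˡ S T)
    spread-along _     (no ¬e) =
      subst (Burning G r S (suc t))
            (sym (undefended-late⇒root G' r (S ++ T) valid (proj₂ (proj₂ ext) e' ¬e l') t≤L ¬def))
            (Burning-root G r S (suc t))

  saved-in-extension : (∀ v → Burning G' r (S ++ T) (length (S ++ T)) v ⊎ v ∈ S ++ T) →
    ∀ {v} → Saved G r S v → Saved G' r (S ++ T) v
  saved-in-extension finished {v} saved t b with finished v
  ... | inj₁ b-end = burning-in-extension ≤-refl b-end (saved _)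
  ... | inj₂ v∈X   = ∈⇒never-burns G' r (S ++ T) valid v∈X b

lemma9 : ∀ {n} (G G' : TemporalGraph n) (r : Fin n) (S T : Strategy n) (k : ℕ) →
    ValidStrategy G r S → SavesAtLeast G r S k →
    Extension G G' → Completion G' r S T →
    SavesAtLeast G' r (S ++ T) k
lemma9 {zero}  _ _ () _ _ _ _ _ _ _
lemma9 {suc m} G G' r S T k _ (f , f-inj , f-saved) ext (valid , finished) =
  f , f-inj , saved-in-extension ext valid finished ∘ f-saved
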